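{- Let $n,m\ge1$, let $f:\mathbb{Z}/n\mathbb{Z}\to\mathbb{Z}/m\mathbb{Z}$, and let $a_0,\dots,a_{n-1}\in\mathbb{Z}/m\mathbb{Z}$ be the unique elements such that $f(x)=\sum_{k=0}^{n-1}a_k\,\big(\binom{x}{k}\bmod m\big)$ for all $x\in\{0,\dots,n-1\}$. Then $f$ is congruence preserving if and only if, for every $k=0,\dots,n-1$, $\mathrm{lcm}(k)$ (considered as an element of $\mathbb{Z}/m\mathbb{Z}$) divides $a_k$ in $\mathbb{Z}/m\mathbb{Z}$.
   Context: Elements of $\mathbb{Z}/n\mathbb{Z}$ are represented by $\{0,\dots,n-1\}$. A function $f:\mathbb{Z}/n\mathbb{Z}\to\mathbb{Z}/m\mathbb{Z}$ is congruence preserving if for every positive divisor $d$ of $m$ and all $a,b\in\{0,\dots,n-1\}$, $a\equiv b\pmod d$ implies $f(a)\equiv f(b)\pmod d$. For $k\ge1$, $\mathrm{lcm}(k)$ is the least common multiple of $1,2,\dots,k$, and $\mathrm{lcm}(0)=1$. An element $c$ divides $a$ in $\mathbb{Z}/m\mathbb{Z}$ if $a=c\,t$ for some $t\in\mathbb{Z}/m\mathbb{Z}$. The existence and uniqueness of the coefficients $a_k$ is part of the setting (every such function has a unique such expansion). -}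

module Defs where

open import Data.Nat using (ℕ; zero; suc; _+_; _*_; ∣_-_∣; NonZero)
open import Data.Nat.DivMod using (_%_)
open import Data.Nat.Divisibility using (_∣_)
open import Data.Nat.LCM using (lcm)
open import Data.Nat.Combinatorics using (_C_)
open import Data.Fin using (Fin; toℕ; fromℕ<)
open import Data.Product using (∃; Σ)
open import Relation.Binary.PropositionalEquality using (_≡_)

-- Elements of ℤ/mℤ are represented by Fin m ≅ {0,…,m-1}.

_≡_[mod_] : ℕ → ℕ → ℕ → Set
a ≡ b [mod d ] = d ∣ ∣ a - b ∣

-- lcm(k) = lcm(1,…,k), lcm(0) = 1
lcmUpTo : ℕ → ℕ
lcmUpTo zero    = 1
lcmUpTo (suc k) = lcm (suc k) (lcmUpTo k)

sumFin : (n : ℕ) → (Fin n → ℕ) → ℕ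
sumFin zero    g = 0
sumFin (suc n) g = g Fin.zero + sumFin n (λ k → g (Fin.suc k))

CongruencePreserving : (n m : ℕ) → (Fin n → Fin m) → Set
CongruencePreserving n m f =
  ∀ (d : ℕ) → d ∣ m → ∀ (a b : Fin n) →
    toℕ a ≡ toℕ b [mod d ] → toℕ (f a) ≡ toℕ (f b) [mod d ]

binomExpansion : (n m : ℕ) .{{_ : NonZero m}} → (Fin n → Fin m) → ℕ → ℕ
binomExpansion n m a x = sumFin n (λ k → toℕ (a k) * ((x C toℕ k) % m)) % m

DividesMod : (m : ℕ) .{{_ : NonZero m}} → ℕ → Fin m → Set
DividesMod m c a = ∃ λ (t : Fin m) → toℕ a ≡ (c * toℕ t) % m

module Submission where

-- The engine of the proof is that
-- x ↦ lcm(k)·C(x, k) preserves every congruence (z ∣ lcm(k)·(C(y+z, k) - C(y, k)),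
-- by Pascal's rule and the absorption identity (k+1)·C(z, k+1) = z·C(z-1, k)).
--  (⇐) If a_k ≡ lcm(k)·t_k (mod M), f is congruent modulo M to a sum of such terms.
--  (⇒) Strong induction on k: subtract the part Σ_{j<k} lcm(j)·t_j·C(x, j) already
--      known; the remainder G preserves congruences, its values below k vanish modulo
--      M and G(k) ≡ a_k, so every divisor e ≤ k of M divides a_k (compare G(k) with
--      G(k - e)).  A gcd/lcm argument upgrades this to gcd(lcm(k), M) ∣ a_k, and
--      Bézout's identity turns that into divisibility by lcm(k) in ℤ/Mℤ.

open import Defs
open import Data.Nat using (ℕ; suc)
open import Data.Fin using (Fin; toℕ)
open import Relation.Binary.PropositionalEquality using (_≡_)
open import Function.Bundles using (_⇔_)

open import Level using (0ℓ)
open import Data.Nat.Base as ℕ using (ℕ; zero; suc; _≤_; _<_; NonZero; ≢-nonZero)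
import Data.Nat.Properties as ℕ
open import Data.Nat.DivMod using (_%_; %-remove-+ˡ; m<n⇒m%n≡m)
open import Data.Nat.Divisibility as ℕ∣
  using (_∣_; divides; ∣-trans; m∣m*n; *-monoˡ-∣; *-monoʳ-∣; *-cancelʳ-∣)
open import Data.Nat.LCM using (lcm; m∣lcm[m,n]; n∣lcm[m,n]; lcm-least; gcd*lcm)
open import Data.Nat.GCD
  using (gcd; gcd[m,n]∣m; gcd[m,n]∣n; gcd-greatest; gcd[m,n]≢0; c*gcd[m,n]≡gcd[cm,cn]; gcd-GCD; module Bézout)
open import Data.Nat.Combinatorics using (_C_; nC1≡n; nCn≡1; k>n⇒nCk≡0; nCk+nC[k+1]≡[n+1]C[k+1])
open import Data.Fin.Base using (Fin; toℕ; fromℕ<) renaming (zero to fzero; suc to fsuc)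
open import Data.Fin.Properties using (suc-injective; toℕ<n; toℕ-fromℕ<; <-cmp)
open import Data.Fin.Induction using (<-wellFounded)
open import Data.Integer.Base using (ℤ; +_; -_; _+_; _*_; _-_; 0ℤ; ∣_∣)
import Data.Integer.Properties as ℤ
import Data.Integer.Divisibility.Signed as ℤ∣
open import Data.Integer.DivMod using (_%ℕ_; _/ℕ_; a≡a%ℕn+[a/ℕn]*n; n%ℕd<d)
open import Data.Integer.Tactic.RingSolver using (solve-∀)
open import Data.Product.Base using (Σ; _,_; proj₁)
open import Data.Sum.Base using (inj₁; inj₂)
open import Function.Base using (_∘_)
open import Function.Bundles using (mk⇔; Equivalence)
open import Induction.WellFounded using (module All)
open import Relation.Binary.Bundles using (Setoid)
open import Relation.Binary.Structures using (IsEquivalence)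
open import Relation.Binary.Definitions using (tri<; tri≈; tri>)
open import Relation.Binary.PropositionalEquality
open import Relation.Nullary.Decidable.Core using (yes; no)
open import Relation.Nullary.Negation using (contradiction)

-- Congruence of integers modulo d.  A record, so that x and y stay inferable.
record _≡_⟨mod_⟩ (x y d : ℤ) : Set where
  constructor mod-cong
  field divides-difference : d ℤ∣.∣ (x - y)
infix 4 _≡_⟨mod_⟩

module _ {d : ℤ} where

  ≡⇒≡-mod : ∀ {x y} → x ≡ y → x ≡ y ⟨mod d ⟩
  ≡⇒≡-mod {x} refl = mod-cong (subst (d ℤ∣.∣_) (sym (ℤ.+-inverseʳ x)) (ℤ∣.divides 0ℤ refl))

  mod-refl : ∀ x → x ≡ x ⟨mod d ⟩
  mod-refl x = ≡⇒≡-mod refl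

  mod-sym : ∀ {x y} → x ≡ y ⟨mod d ⟩ → y ≡ x ⟨mod d ⟩
  mod-sym {x} {y} (mod-cong p) = mod-cong (subst (d ℤ∣.∣_) (negate x y) (ℤ∣.∣m⇒∣-m p))
    where
    negate : ∀ x y → - (x - y) ≡ y - x
    negate = solve-∀

  mod-trans : ∀ {x y z} → x ≡ y ⟨mod d ⟩ → y ≡ z ⟨mod d ⟩ → x ≡ z ⟨mod d ⟩
  mod-trans {x} {y} {z} (mod-cong p) (mod-cong q) =
    mod-cong (subst (d ℤ∣.∣_) (telescope x y z) (ℤ∣.∣m∣n⇒∣m+n p q))
    where
    telescope : ∀ x y z → (x - y) + (y - z) ≡ x - z
    telescope = solve-∀

  mod-+ : ∀ {x x′ y y′} → x ≡ x′ ⟨mod d ⟩ → y ≡ y′ ⟨mod d ⟩ → x + y ≡ x′ + y′ ⟨mod d ⟩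
  mod-+ {x} {x′} {y} {y′} (mod-cong p) (mod-cong q) =
    mod-cong (subst (d ℤ∣.∣_) (regroup x x′ y y′) (ℤ∣.∣m∣n⇒∣m+n p q))
    where
    regroup : ∀ x x′ y y′ → (x - x′) + (y - y′) ≡ (x + y) - (x′ + y′)
    regroup = solve-∀

  mod-- : ∀ {x x′ y y′} → x ≡ x′ ⟨mod d ⟩ → y ≡ y′ ⟨mod d ⟩ → x - y ≡ x′ - y′ ⟨mod d ⟩
  mod-- {x} {x′} {y} {y′} (mod-cong p) (mod-cong q) =
    mod-cong (subst (d ℤ∣.∣_) (regroup x x′ y y′) (ℤ∣.∣m∣n⇒∣m-n p q))
    where
    regroup : ∀ x x′ y y′ → (x - x′) - (y - y′) ≡ (x - y) - (x′ - y′)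
    regroup = solve-∀

  mod-*ˡ : ∀ c {x y} → x ≡ y ⟨mod d ⟩ → c * x ≡ c * y ⟨mod d ⟩
  mod-*ˡ c {x} {y} (mod-cong p) = mod-cong (subst (d ℤ∣.∣_) (distrib c x y) (ℤ∣.∣n⇒∣m*n c p))
    where
    distrib : ∀ c x y → c * (x - y) ≡ c * x - c * y
    distrib = solve-∀

  mod-*ʳ : ∀ c {x y} → x ≡ y ⟨mod d ⟩ → x * c ≡ y * c ⟨mod d ⟩
  mod-*ʳ c {x} {y} p =
    subst₂ (_≡_⟨mod d ⟩) (ℤ.*-comm c x) (ℤ.*-comm c y) (mod-*ˡ c p)

  mod-isEquivalence : IsEquivalence (_≡_⟨mod d ⟩)
  mod-isEquivalence = record
    { refl = mod-refl _ ; sym = mod-sym ; trans = mod-trans }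

≡-mod⇒difference≡0 : ∀ {d x y} → x ≡ y ⟨mod d ⟩ → x - y ≡ 0ℤ ⟨mod d ⟩
≡-mod⇒difference≡0 {d} {x} {y} (mod-cong p) =
  mod-cong (subst (d ℤ∣.∣_) (sym (ℤ.+-identityʳ (x - y))) p)

mod-weaken : ∀ {e d x y} → e ℤ∣.∣ d → x ≡ y ⟨mod d ⟩ → x ≡ y ⟨mod e ⟩
mod-weaken e∣d (mod-cong p) = mod-cong (ℤ∣.∣-trans e∣d p)

mod-setoid : ℤ → Setoid 0ℓ 0ℓ
mod-setoid d = record { isEquivalence = mod-isEquivalence {d} }

module ModReasoning (d : ℤ) where
  open import Relation.Binary.Reasoning.Setoid (mod-setoid d) public

∣[+m]-[+n]∣≡∣m-n∣ : ∀ m n → ∣ + m - + n ∣ ≡ ℕ.∣ m - n ∣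
∣[+m]-[+n]∣≡∣m-n∣ m n with ℕ.≤-total m n
... | inj₁ m≤n = trans (cong ∣_∣ (ℤ.m-n≡m⊖n m n))
                   (trans (ℤ.∣⊖∣-≤ m≤n) (sym (ℕ.m≤n⇒∣m-n∣≡n∸m m≤n)))
... | inj₂ n≤m = trans (cong ∣_∣ (ℤ.m-n≡m⊖n m n))
                   (trans (ℤ.∣m⊖n∣≡∣n⊖m∣ m n)
                     (trans (ℤ.∣⊖∣-≤ n≤m) (sym (ℕ.m≤n⇒∣n-m∣≡n∸m n≤m))))

∣-dist⇒≡-mod : ∀ {d} m n → d ∣ ℕ.∣ m - n ∣ → + m ≡ + n ⟨mod + d ⟩
∣-dist⇒≡-mod m n p = mod-cong (ℤ∣.∣ᵤ⇒∣ (subst (_ ∣_) (sym (∣[+m]-[+n]∣≡∣m-n∣ m n)) p))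

≡-mod⇒∣-dist : ∀ {d} m n → + m ≡ + n ⟨mod + d ⟩ → d ∣ ℕ.∣ m - n ∣
≡-mod⇒∣-dist m n (mod-cong p) = subst (_ ∣_) (∣[+m]-[+n]∣≡∣m-n∣ m n) (ℤ∣.∣⇒∣ᵤ p)

∣⇒≡-mod-0 : ∀ {d} m → d ∣ m → + m ≡ 0ℤ ⟨mod + d ⟩
∣⇒≡-mod-0 {d} m p = mod-cong (subst (+ d ℤ∣.∣_) (sym (ℤ.+-identityʳ (+ m))) (ℤ∣.∣ᵤ⇒∣ p))

≡-mod-0⇒∣ : ∀ {d} m → + m ≡ 0ℤ ⟨mod + d ⟩ → d ∣ m
≡-mod-0⇒∣ {d} m (mod-cong p) = ℤ∣.∣⇒∣ᵤ (subst (+ d ℤ∣.∣_) (ℤ.+-identityʳ (+ m)) p)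

%ℕ-≡-mod : ∀ w M .{{_ : NonZero M}} → + (w %ℕ M) ≡ w ⟨mod + M ⟩
%ℕ-≡-mod w M = mod-cong (ℤ∣.divides (- (w /ℕ M)) (begin
    + r - w               ≡⟨ cong (λ t → + r - t) (a≡a%ℕn+[a/ℕn]*n w M) ⟩
    + r - (+ r + q * + M) ≡⟨ cancel (+ r) q (+ M) ⟩
    - q * + M             ∎))
  where
  open ≡-Reasoning
  r = w %ℕ M
  q = w /ℕ M
  cancel : ∀ r q M → r - (r + q * M) ≡ - q * M
  cancel = solve-∀

private
  ≡-mod⇒%≡-ordered : ∀ {m n} M .{{_ : NonZero M}} → n ℕ.≤ m →
                     + m ≡ + n ⟨mod + M ⟩ → m % M ≡ n % M
  ≡-mod⇒%≡-ordered {m} {n} M n≤m p = trans (cong (_% M) (sym (ℕ.m∸n+n≡m n≤m)))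
    (%-remove-+ˡ n (subst (M ∣_) (ℕ.m≤n⇒∣n-m∣≡n∸m n≤m) (≡-mod⇒∣-dist m n p)))

≡-mod⇒%≡ : ∀ m n M .{{_ : NonZero M}} → + m ≡ + n ⟨mod + M ⟩ → m % M ≡ n % M
≡-mod⇒%≡ m n M p with ℕ.≤-total n m
... | inj₁ n≤m = ≡-mod⇒%≡-ordered M n≤m p
... | inj₂ m≤n = sym (≡-mod⇒%≡-ordered M m≤n (mod-sym p))

sumℤ : (n : ℕ) → (Fin n → ℤ) → ℤ
sumℤ zero    g = 0ℤ
sumℤ (suc n) g = g fzero + sumℤ n (g ∘ fsuc)

sumFin≡sumℤ : ∀ n (g : Fin n → ℕ) → + sumFin n g ≡ sumℤ n (+_ ∘ g)
sumFin≡sumℤ zero    g = refl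
sumFin≡sumℤ (suc n) g =
  trans (ℤ.pos-+ (g fzero) _) (cong (λ t → + g fzero + t) (sumFin≡sumℤ n (g ∘ fsuc)))

sumℤ-sub : ∀ n {f g h : Fin n → ℤ} → (∀ k → f k - g k ≡ h k) →
           sumℤ n f - sumℤ n g ≡ sumℤ n h
sumℤ-sub zero    eq = refl
sumℤ-sub (suc n) {f} {g} eq =
  trans (regroup (f fzero) (g fzero) (sumℤ n (f ∘ fsuc)) (sumℤ n (g ∘ fsuc)))
        (cong₂ _+_ (eq fzero) (sumℤ-sub n (eq ∘ fsuc)))
  where
  regroup : ∀ a b x y → (a + x) - (b + y) ≡ (a - b) + (x - y)
  regroup = solve-∀

module _ {d : ℤ} where

  sumℤ-cong : ∀ n {f g : Fin n → ℤ} → (∀ k → f k ≡ g k ⟨mod d ⟩) →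
              sumℤ n f ≡ sumℤ n g ⟨mod d ⟩
  sumℤ-cong zero    h = mod-refl 0ℤ
  sumℤ-cong (suc n) h = mod-+ (h fzero) (sumℤ-cong n (h ∘ fsuc))

  sumℤ-vanishing : ∀ n {f : Fin n → ℤ} → (∀ k → f k ≡ 0ℤ ⟨mod d ⟩) → sumℤ n f ≡ 0ℤ ⟨mod d ⟩
  sumℤ-vanishing zero    h = mod-refl 0ℤ
  sumℤ-vanishing (suc n) h = mod-+ (h fzero) (sumℤ-vanishing n (h ∘ fsuc))

  sumℤ-single : ∀ n (f : Fin n → ℤ) k → (∀ j → j ≢ k → f j ≡ 0ℤ ⟨mod d ⟩) →
                sumℤ n f ≡ f k ⟨mod d ⟩
  sumℤ-single (suc n) f fzero    h =
    mod-trans (mod-+ (mod-refl (f fzero)) (sumℤ-vanishing n (λ j → h (fsuc j) λ ())))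
              (≡⇒≡-mod (ℤ.+-identityʳ (f fzero)))
  sumℤ-single (suc n) f (fsuc k) h =
    mod-trans (mod-+ (h fzero λ ()) (sumℤ-single n (f ∘ fsuc) k
                       (λ j j≢k → h (fsuc j) (j≢k ∘ suc-injective))))
              (≡⇒≡-mod (ℤ.+-identityˡ (f (fsuc k))))

absorption : ∀ w k → suc k ℕ.* (suc w C suc k) ≡ suc w ℕ.* (w C k)
absorption zero    zero    = refl
absorption zero    (suc k) = ℕ.*-zeroʳ (suc (suc k))
absorption (suc w) zero    = trans (ℕ.*-identityˡ _) (trans (nC1≡n (suc (suc w))) (sym (ℕ.*-identityʳ _)))
absorption (suc w) (suc k) = begin
  suc (suc k) ℕ.* (suc (suc w) C suc (suc k))
    ≡⟨ cong (suc (suc k) ℕ.*_) (sym (nCk+nC[k+1]≡[n+1]C[k+1] (suc w) (suc k))) ⟩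
  suc (suc k) ℕ.* (P ℕ.+ Q)
    ≡⟨ ℕ.*-distribˡ-+ (suc (suc k)) P Q ⟩
  (P ℕ.+ suc k ℕ.* P) ℕ.+ suc (suc k) ℕ.* Q
    ≡⟨ ℕ.+-assoc P (suc k ℕ.* P) _ ⟩
  P ℕ.+ (suc k ℕ.* P ℕ.+ suc (suc k) ℕ.* Q)
    ≡⟨ cong₂ (λ u v → P ℕ.+ (u ℕ.+ v)) (absorption w k) (absorption w (suc k)) ⟩
  P ℕ.+ (suc w ℕ.* (w C k) ℕ.+ suc w ℕ.* (w C suc k))
    ≡⟨ cong (P ℕ.+_) (sym (ℕ.*-distribˡ-+ (suc w) (w C k) (w C suc k))) ⟩
  P ℕ.+ suc w ℕ.* (w C k ℕ.+ w C suc k)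
    ≡⟨ cong (λ u → P ℕ.+ suc w ℕ.* u) (nCk+nC[k+1]≡[n+1]C[k+1] w k) ⟩
  suc (suc w) ℕ.* P ∎
  where
  open ≡-Reasoning
  P = suc w C suc k
  Q = suc w C suc (suc k)

-- The base case of the key congruence:  z ∣ lcm(k+1)·C(z, k+1),
-- since (k+1)·C(z, k+1) = z·C(z-1, k) and k+1 ∣ lcm(k+1).
∣lcm*binom : ∀ z k → z ∣ lcmUpTo (suc k) ℕ.* (z C suc k)
∣lcm*binom zero    k = subst (0 ∣_) (sym (ℕ.*-zeroʳ (lcmUpTo (suc k)))) ℕ∣.∣-refl
∣lcm*binom (suc w) k =
  ∣-trans (subst (suc w ∣_) (sym (absorption w k)) (m∣m*n (w C k)))
          (*-monoˡ-∣ (suc w C suc k) (m∣lcm[m,n] (suc k) (lcmUpTo k)))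

lcmBinom : ℕ → ℕ → ℤ
lcmBinom k x = + lcmUpTo k * + (x C k)

lcmBinom-pascal : ∀ k x r → lcmUpTo (suc k) ≡ r ℕ.* lcmUpTo k →
                  lcmBinom (suc k) (suc x) ≡ + r * lcmBinom k x + lcmBinom (suc k) x
lcmBinom-pascal k x r L≡rL = begin
  + L′ * + (suc x C suc k)             ≡⟨ cong (λ t → + L′ * + t) (sym (nCk+nC[k+1]≡[n+1]C[k+1] x k)) ⟩
  + L′ * + (x C k ℕ.+ x C suc k)       ≡⟨ cong (λ t → + L′ * t) (ℤ.pos-+ (x C k) _) ⟩
  + L′ * (+ (x C k) + + (x C suc k))   ≡⟨ ℤ.*-distribˡ-+ (+ L′) (+ (x C k)) _ ⟩
  + L′ * + (x C k) + + L′ * + (x C suc k)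
    ≡⟨ cong (λ t → t * + (x C k) + + L′ * + (x C suc k)) (trans (cong +_ L≡rL) (ℤ.pos-* r _)) ⟩
  (+ r * + lcmUpTo k) * + (x C k) + + L′ * + (x C suc k)
    ≡⟨ cong (λ t → t + + L′ * + (x C suc k)) (ℤ.*-assoc (+ r) (+ lcmUpTo k) _) ⟩
  + r * lcmBinom k x + lcmBinom (suc k) x ∎
  where
  open ≡-Reasoning
  L′ = lcmUpTo (suc k)

lcmBinom-shift : ∀ k y z → lcmBinom k (y ℕ.+ z) ≡ lcmBinom k y ⟨mod + z ⟩
lcmBinom-shift zero    y       z = mod-refl (lcmBinom zero y)
lcmBinom-shift (suc k) zero    z = begin
  + lcmUpTo (suc k) * + (z C suc k)   ≡⟨ ℤ.pos-* (lcmUpTo (suc k)) (z C suc k) ⟨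
  + (lcmUpTo (suc k) ℕ.* (z C suc k)) ≈⟨ ∣⇒≡-mod-0 _ (∣lcm*binom z k) ⟩
  0ℤ                                  ≡⟨ ℤ.*-zeroʳ (+ lcmUpTo (suc k)) ⟨
  lcmBinom (suc k) zero               ∎
  where open ModReasoning (+ z)
lcmBinom-shift (suc k) (suc y) z with n∣lcm[m,n] (suc k) (lcmUpTo k)
... | divides r L≡rL = begin
  lcmBinom (suc k) (suc (y ℕ.+ z))                        ≡⟨ lcmBinom-pascal k (y ℕ.+ z) r L≡rL ⟩
  + r * lcmBinom k (y ℕ.+ z) + lcmBinom (suc k) (y ℕ.+ z) ≈⟨ mod-+ (mod-*ˡ (+ r) (lcmBinom-shift k y z))
                                                                   (lcmBinom-shift (suc k) y z) ⟩
  + r * lcmBinom k y + lcmBinom (suc k) y                 ≡⟨ lcmBinom-pascal k y r L≡rL ⟨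
  lcmBinom (suc k) (suc y)                                ∎
  where open ModReasoning (+ z)

private
  lcmBinom-cong-ordered : ∀ k {d x y} → y ≤ x → d ∣ ℕ.∣ x - y ∣ →
                          lcmBinom k x ≡ lcmBinom k y ⟨mod + d ⟩
  lcmBinom-cong-ordered k {d} {x} {y} y≤x d∣x-y =
    subst (λ t → lcmBinom k t ≡ lcmBinom k y ⟨mod + d ⟩) (ℕ.m+[n∸m]≡n y≤x)
          (mod-weaken (ℤ∣.∣ᵤ⇒∣ (subst (d ∣_) (ℕ.m≤n⇒∣n-m∣≡n∸m y≤x) d∣x-y))
                      (lcmBinom-shift k y (x ℕ.∸ y)))

lcmBinom-cong : ∀ k {d} x y → d ∣ ℕ.∣ x - y ∣ → lcmBinom k x ≡ lcmBinom k y ⟨mod + d ⟩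
lcmBinom-cong k {d} x y d∣x-y with ℕ.≤-total y x
... | inj₁ y≤x = lcmBinom-cong-ordered k y≤x d∣x-y
... | inj₂ x≤y = mod-sym (lcmBinom-cong-ordered k x≤y (subst (d ∣_) (ℕ.∣-∣-comm x y) d∣x-y))

binomSum : ∀ {n} → (Fin n → ℤ) → ℕ → ℤ
binomSum {n} c x = sumℤ n (λ j → c j * + (x C toℕ j))

binomSum-sub : ∀ {n} (c c′ : Fin n → ℤ) x →
               binomSum c x - binomSum c′ x ≡ binomSum (λ j → c j - c′ j) x
binomSum-sub {n} c c′ x = sumℤ-sub n (λ j → factor (c j) (c′ j) (+ (x C toℕ j)))
  where
  factor : ∀ a b t → a * t - b * t ≡ (a - b) * t
  factor = solve-∀

binomSum-cong : ∀ {n d} {c c′ : Fin n → ℤ} → (∀ j → c j ≡ c′ j ⟨mod d ⟩) →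
                ∀ x → binomSum c x ≡ binomSum c′ x ⟨mod d ⟩
binomSum-cong {n} c≡c′ x = sumℤ-cong n (λ j → mod-*ʳ (+ (x C toℕ j)) (c≡c′ j))

lcmMultiples : ∀ {n} → (Fin n → ℤ) → Fin n → ℤ
lcmMultiples t j = + lcmUpTo (toℕ j) * t j

binomSum-lcmMultiples-cong : ∀ {n d} (t : Fin n → ℤ) x y → d ∣ ℕ.∣ x - y ∣ →
  binomSum (lcmMultiples t) x ≡ binomSum (lcmMultiples t) y ⟨mod + d ⟩
binomSum-lcmMultiples-cong {n} {d} t x y d∣x-y = sumℤ-cong n λ j → begin
  (+ lcmUpTo (toℕ j) * t j) * + (x C toℕ j) ≡⟨ reorder (+ lcmUpTo (toℕ j)) (t j) (+ (x C toℕ j)) ⟩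
  t j * lcmBinom (toℕ j) x                  ≈⟨ mod-*ˡ (t j) (lcmBinom-cong (toℕ j) x y d∣x-y) ⟩
  t j * lcmBinom (toℕ j) y                  ≡⟨ reorder (+ lcmUpTo (toℕ j)) (t j) (+ (y C toℕ j)) ⟨
  (+ lcmUpTo (toℕ j) * t j) * + (y C toℕ j) ∎
  where
  open ModReasoning (+ d)
  reorder : ∀ L t b → (L * t) * b ≡ t * (L * b)
  reorder = solve-∀

binomSum-triangular : ∀ {n d} (c : Fin n → ℤ) k → (∀ j → toℕ j < toℕ k → c j ≡ 0ℤ ⟨mod d ⟩) →
  ∀ {x} → x ≤ toℕ k → binomSum c x ≡ c k * + (x C toℕ k) ⟨mod d ⟩
binomSum-triangular {n} {d} c k low {x} x≤k = sumℤ-single n _ k other-terms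
  where
  other-terms : ∀ j → j ≢ k → c j * + (x C toℕ j) ≡ 0ℤ ⟨mod d ⟩
  other-terms j j≢k with <-cmp j k
  ... | tri< j<k _ _ = mod-trans (mod-*ʳ _ (low j j<k)) (≡⇒≡-mod (ℤ.*-zeroˡ (+ (x C toℕ j))))
  ... | tri≈ _ j≡k _ = contradiction j≡k j≢k
  ... | tri> _ _ k<j = ≡⇒≡-mod (trans (cong (λ t → c j * + t) (k>n⇒nCk≡0 (ℕ.≤-<-trans x≤k k<j)))
                                       (ℤ.*-zeroʳ (c j)))

PreservesCong : ∀ {n} → ℕ → (Fin n → ℤ) → Set
PreservesCong {n} M F =
  ∀ e → e ∣ M → ∀ x y → e ∣ ℕ.∣ toℕ x - toℕ y ∣ → F x ≡ F y ⟨mod + e ⟩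

congruencePreserving⇔ : ∀ {n M} (f : Fin n → Fin M) →
  CongruencePreserving n M f ⇔ PreservesCong M (λ x → + toℕ (f x))
congruencePreserving⇔ f = mk⇔
  (λ cp e e∣M x y e∣x-y → ∣-dist⇒≡-mod _ _ (cp e e∣M x y e∣x-y))
  (λ pc e e∣M x y e∣x-y → ≡-mod⇒∣-dist _ _ (pc e e∣M x y e∣x-y))

preservesCong-sub : ∀ {n M} {F G : Fin n → ℤ} → PreservesCong M F → PreservesCong M G →
                    PreservesCong M (λ x → F x - G x)
preservesCong-sub pF pG e e∣M x y e∣x-y = mod-- (pF e e∣M x y e∣x-y) (pG e e∣M x y e∣x-y)

preservesCong-resp : ∀ {n M} {F G : Fin n → ℤ} → (∀ x → G x ≡ F x ⟨mod + M ⟩) →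
                     PreservesCong M F → PreservesCong M G
preservesCong-resp {M = M} {F} {G} G≡F pF e e∣M x y e∣x-y = begin
  G x ≈⟨ weaken (G≡F x) ⟩
  F x ≈⟨ pF e e∣M x y e∣x-y ⟩
  F y ≈⟨ weaken (G≡F y) ⟨
  G y ∎
  where
  open ModReasoning (+ e)
  weaken : ∀ {u v} → u ≡ v ⟨mod + M ⟩ → u ≡ v ⟨mod + e ⟩
  weaken = mod-weaken (ℤ∣.∣ᵤ⇒∣ e∣M)

∣m-[m∸n]∣≡n : ∀ {m n} → n ≤ m → ℕ.∣ m - (m ℕ.∸ n) ∣ ≡ n
∣m-[m∸n]∣≡n {m} {n} n≤m = trans (ℕ.m≤n⇒∣n-m∣≡n∸m (ℕ.m∸n≤m m n)) (ℕ.m∸[m∸n]≡n n≤m)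

leading-coefficient : ∀ {n} M (F r : Fin n → ℤ) (k : Fin n) →
  PreservesCong M F → (∀ x → F x ≡ binomSum r (toℕ x) ⟨mod + M ⟩) →
  (∀ j → toℕ j < toℕ k → r j ≡ 0ℤ ⟨mod + M ⟩) →
  ∀ e → e ∣ M → 0 < e → e ≤ toℕ k → r k ≡ 0ℤ ⟨mod + e ⟩
leading-coefficient {n} M F r k pF F≡r low e e∣M 0<e e≤k = begin
  r k                     ≡⟨ ℤ.*-identityʳ (r k) ⟨
  r k * + 1               ≡⟨ cong (λ t → r k * + t) (nCn≡1 (toℕ k)) ⟨
  r k * + (toℕ k C toℕ k) ≈⟨ weaken (value-at k ℕ.≤-refl) ⟨
  F k                     ≈⟨ pF e e∣M k y e∣k-y ⟩
  F y                     ≈⟨ weaken (value-at y (ℕ.<⇒≤ y<k)) ⟩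
  r k * + (toℕ y C toℕ k) ≡⟨ cong (λ t → r k * + t) (k>n⇒nCk≡0 y<k) ⟩
  r k * + 0               ≡⟨ ℤ.*-zeroʳ (r k) ⟩
  0ℤ                      ∎
  where
  open ModReasoning (+ e)
  weaken : ∀ {u v} → u ≡ v ⟨mod + M ⟩ → u ≡ v ⟨mod + e ⟩
  weaken = mod-weaken (ℤ∣.∣ᵤ⇒∣ e∣M)
  value-at : ∀ x → toℕ x ≤ toℕ k → F x ≡ r k * + (toℕ x C toℕ k) ⟨mod + M ⟩
  value-at x x≤k = mod-trans (F≡r x) (binomSum-triangular r k low x≤k)
  y : Fin n
  y = fromℕ< (ℕ.≤-<-trans (ℕ.m∸n≤m (toℕ k) e) (toℕ<n k))
  toℕ-y : toℕ y ≡ toℕ k ℕ.∸ e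
  toℕ-y = toℕ-fromℕ< _
  y<k : toℕ y < toℕ k
  y<k = subst (_< toℕ k) (sym toℕ-y) (ℕ.∸-monoʳ-< {toℕ k} {e} {0} 0<e e≤k)
  e∣k-y : e ∣ ℕ.∣ toℕ k - toℕ y ∣
  e∣k-y = subst (e ∣_) (sym (trans (cong (λ t → ℕ.∣ toℕ k - t ∣) toℕ-y) (∣m-[m∸n]∣≡n e≤k))) ℕ∣.∣-refl

-- With p = gcd(d,u), q = gcd(d,v), r = gcd(p,q) we show d·r ∣ p·q = lcm(p,q)·r:
-- from d·gcd(u,v) ∣ u·v we get d·r ∣ gcd(d·u, u·v) = u·q and then d·r ∣ gcd(d·q, u·q) = p·q.
∣lcm⇒∣lcm-gcd : ∀ d u v → d ≢ 0 → d ∣ lcm u v → d ∣ lcm (gcd d u) (gcd d v)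
∣lcm⇒∣lcm-gcd d u v d≢0 d∣lcm = *-cancelʳ-∣ r {{r≢0}} dr∣lcm·r
  where
  p = gcd d u
  q = gcd d v
  r = gcd p q
  r≢0 : NonZero r
  r≢0 = ≢-nonZero (gcd[m,n]≢0 p q (inj₁ (gcd[m,n]≢0 d u (inj₁ d≢0))))
  r∣u : r ∣ u
  r∣u = ∣-trans (gcd[m,n]∣m p q) (gcd[m,n]∣n d u)
  r∣v : r ∣ v
  r∣v = ∣-trans (gcd[m,n]∣n p q) (gcd[m,n]∣n d v)
  dr∣uv : d ℕ.* r ∣ u ℕ.* v
  dr∣uv = ∣-trans (*-monoʳ-∣ d (gcd-greatest r∣u r∣v))
    (subst₂ _∣_ (ℕ.*-comm (gcd u v) d) (gcd*lcm u v) (*-monoʳ-∣ (gcd u v) d∣lcm))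
  dr∣uq : d ℕ.* r ∣ u ℕ.* q
  dr∣uq = subst (d ℕ.* r ∣_) (sym (c*gcd[m,n]≡gcd[cm,cn] u d v))
    (gcd-greatest (subst (d ℕ.* r ∣_) (ℕ.*-comm d u) (*-monoʳ-∣ d r∣u)) dr∣uv)
  dr∣pq : d ℕ.* r ∣ p ℕ.* q
  dr∣pq = subst (d ℕ.* r ∣_) (trans (sym (c*gcd[m,n]≡gcd[cm,cn] q d u)) (ℕ.*-comm q p))
    (gcd-greatest (subst (d ℕ.* r ∣_) (ℕ.*-comm d q) (*-monoʳ-∣ d (gcd[m,n]∣n p q)))
                  (subst (d ℕ.* r ∣_) (ℕ.*-comm u q) dr∣uq))
  dr∣lcm·r : d ℕ.* r ∣ lcm p q ℕ.* r
  dr∣lcm·r = subst (d ℕ.* r ∣_) (trans (sym (gcd*lcm p q)) (ℕ.*-comm r (lcm p q))) dr∣pq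

bounded-divisors : ∀ {M A} K → M ≢ 0 → (∀ e → e ∣ M → 0 < e → e ≤ K → e ∣ A) →
                   ∀ d → d ∣ M → d ∣ lcmUpTo K → d ∣ A
bounded-divisors {A = A} zero M≢0 small d d∣M d∣1 rewrite ℕ∣.∣1⇒≡1 d∣1 = ℕ∣.1∣ A
bounded-divisors {M} {A} (suc K) M≢0 small d d∣M d∣lcm =
  ∣-trans (∣lcm⇒∣lcm-gcd d (suc K) (lcmUpTo K) d≢0 d∣lcm) (lcm-least p∣A q∣A)
  where
  d≢0 : d ≢ 0
  d≢0 refl = M≢0 (ℕ∣.0∣⇒≡0 d∣M)
  p = gcd d (suc K)
  q = gcd d (lcmUpTo K)
  p∣A : p ∣ A
  p∣A = small p (∣-trans (gcd[m,n]∣m d (suc K)) d∣M)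
              (ℕ.n≢0⇒n>0 (gcd[m,n]≢0 d (suc K) (inj₁ d≢0)))
              (ℕ∣.∣⇒≤ (gcd[m,n]∣n d (suc K)))
  q∣A : q ∣ A
  q∣A = bounded-divisors K M≢0 (λ e e∣M 0<e e≤K → small e e∣M 0<e (ℕ.m≤n⇒m≤1+n e≤K))
          q (∣-trans (gcd[m,n]∣m d (lcmUpTo K)) d∣M) (gcd[m,n]∣n d (lcmUpTo K))

multiple≡0 : ∀ q d → q * d ≡ 0ℤ ⟨mod d ⟩
multiple≡0 q d = mod-cong (ℤ∣.divides q (ℤ.+-identityʳ (q * d)))

private
  pos-+-* : ∀ a b c → + (a ℕ.+ b ℕ.* c) ≡ + a + + b * + c
  pos-+-* a b c = trans (ℤ.pos-+ a (b ℕ.* c)) (cong (λ t → + a + t) (ℤ.pos-* b c))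

bézout-mod : ∀ M L → Σ ℤ λ s → + gcd L M ≡ s * + L ⟨mod + M ⟩
bézout-mod M L with Bézout.identity (gcd-GCD L M)
... | Bézout.+- x y g+yM≡xL = + x , (begin
  + g             ≡⟨ ℤ.+-identityʳ (+ g) ⟨
  + g + 0ℤ        ≈⟨ mod-+ (mod-refl (+ g)) (multiple≡0 (+ y) (+ M)) ⟨
  + g + + y * + M ≡⟨ pos-+-* g y M ⟨
  + (g ℕ.+ y ℕ.* M) ≡⟨ cong +_ g+yM≡xL ⟩
  + (x ℕ.* L)     ≡⟨ ℤ.pos-* x L ⟩
  + x * + L       ∎)
  where
  open ModReasoning (+ M)
  g = gcd L M
... | Bézout.-+ x y g+xL≡yM = - + x , (begin
  + g                           ≡⟨ split (+ g) (+ x * + L) ⟩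
  (+ g + + x * + L) - + x * + L ≈⟨ mod-- g+xL≡0 (mod-refl (+ x * + L)) ⟩
  0ℤ - + x * + L                ≡⟨ negate (+ x) (+ L) ⟩
  - + x * + L                   ∎)
  where
  open ModReasoning (+ M)
  g = gcd L M
  split : ∀ a b → a ≡ (a + b) - b
  split = solve-∀
  negate : ∀ a b → 0ℤ - a * b ≡ - a * b
  negate = solve-∀
  g+xL≡0 : + g + + x * + L ≡ 0ℤ ⟨mod + M ⟩
  g+xL≡0 = begin
    + g + + x * + L   ≡⟨ pos-+-* g x L ⟨
    + (g ℕ.+ x ℕ.* L) ≡⟨ cong +_ g+xL≡yM ⟩
    + (y ℕ.* M)       ≡⟨ ℤ.pos-* y M ⟩
    + y * + M         ≈⟨ multiple≡0 (+ y) (+ M) ⟩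
    0ℤ                ∎

-- If gcd(L, M) divides a, then L divides a in ℤ/Mℤ: with a = c·gcd(L, M) and
-- Bézout's s, the element t = c·s mod M satisfies a ≡ L·t (mod M).
gcd∣⇒dividesMod : ∀ M L .{{_ : NonZero M}} (a : Fin M) → gcd L M ∣ toℕ a → DividesMod M L a
gcd∣⇒dividesMod M L a (divides c a≡cg) with bézout-mod M L
... | s , g≡sL = fromℕ< (n%ℕd<d w M) , same-residue
  where
  w = + c * s
  a≡Lt : + toℕ a ≡ + (L ℕ.* (w %ℕ M)) ⟨mod + M ⟩
  a≡Lt = begin
    + toℕ a                ≡⟨ trans (cong +_ a≡cg) (ℤ.pos-* c (gcd L M)) ⟩
    + c * + gcd L M        ≈⟨ mod-*ˡ (+ c) g≡sL ⟩
    + c * (s * + L)        ≡⟨ regroup (+ c) s (+ L) ⟩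
    + L * w                ≈⟨ mod-*ˡ (+ L) (%ℕ-≡-mod w M) ⟨
    + L * + (w %ℕ M)       ≡⟨ ℤ.pos-* L (w %ℕ M) ⟨
    + (L ℕ.* (w %ℕ M))     ∎
    where
    open ModReasoning (+ M)
    regroup : ∀ c s L → c * (s * L) ≡ L * (c * s)
    regroup = solve-∀
  same-residue : toℕ a ≡ (L ℕ.* toℕ (fromℕ< (n%ℕd<d w M))) % M
  same-residue = begin
    toℕ a                ≡⟨ m<n⇒m%n≡m (toℕ<n a) ⟨
    toℕ a % M            ≡⟨ ≡-mod⇒%≡ (toℕ a) (L ℕ.* (w %ℕ M)) M a≡Lt ⟩
    (L ℕ.* (w %ℕ M)) % M ≡⟨ cong (λ t → (L ℕ.* t) % M) (toℕ-fromℕ< (n%ℕd<d w M)) ⟨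
    (L ℕ.* toℕ (fromℕ< (n%ℕd<d w M))) % M ∎
    where open ≡-Reasoning

dividesMod⇒≡-mod : ∀ M L .{{_ : NonZero M}} (a : Fin M) → (div : DividesMod M L a) →
                   + toℕ a ≡ + L * + toℕ (proj₁ div) ⟨mod + M ⟩
dividesMod⇒≡-mod M L a (t , a≡Lt%M) = begin
  + toℕ a                ≡⟨ cong +_ a≡Lt%M ⟩
  + ((L ℕ.* toℕ t) % M)  ≈⟨ %ℕ-≡-mod (+ (L ℕ.* toℕ t)) M ⟩
  + (L ℕ.* toℕ t)        ≡⟨ ℤ.pos-* L (toℕ t) ⟩
  + L * + toℕ t          ∎
  where open ModReasoning (+ M)

coordinates : ∀ {N M} → (Fin N → Fin M) → Fin N → ℤ
coordinates a k = + toℕ (a k)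

binomExpansion≡binomSum : ∀ N M .{{_ : NonZero M}} (a : Fin N → Fin M) x →
  + binomExpansion N M a x ≡ binomSum (coordinates a) x ⟨mod + M ⟩
binomExpansion≡binomSum N M a x = begin
  + (sumFin N term % M)  ≈⟨ %ℕ-≡-mod (+ sumFin N term) M ⟩
  + sumFin N term        ≡⟨ sumFin≡sumℤ N term ⟩
  sumℤ N (+_ ∘ term)     ≈⟨ sumℤ-cong N reduce ⟩
  binomSum (coordinates a) x ∎
  where
  open ModReasoning (+ M)
  term : Fin N → ℕ
  term k = toℕ (a k) ℕ.* ((x C toℕ k) % M)
  reduce : ∀ k → + term k ≡ coordinates a k * + (x C toℕ k) ⟨mod + M ⟩
  reduce k = mod-trans (≡⇒≡-mod (ℤ.pos-* (toℕ (a k)) _))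
                       (mod-*ˡ (coordinates a k) (%ℕ-≡-mod (+ (x C toℕ k)) M))

-- (⇐)  If lcm(k) divides a_k in ℤ/Mℤ for every k, then F ≡ Σ_k lcm(k)·t_k·C(x, k)
-- (mod M), a sum of congruence-preserving terms.
divisibility⇒preservesCong : ∀ {N M} .{{_ : NonZero M}} (F : Fin N → ℤ) (a : Fin N → Fin M) →
  (∀ x → F x ≡ binomSum (coordinates a) (toℕ x) ⟨mod + M ⟩) →
  (∀ k → DividesMod M (lcmUpTo (toℕ k)) (a k)) → PreservesCong M F
divisibility⇒preservesCong {M = M} F a F≡A div =
  preservesCong-resp F≡lcmSum (λ e _ x y → binomSum-lcmMultiples-cong t (toℕ x) (toℕ y))
  where
  t : Fin _ → ℤ
  t k = + toℕ (proj₁ (div k))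
  F≡lcmSum : ∀ x → F x ≡ binomSum (lcmMultiples t) (toℕ x) ⟨mod + M ⟩
  F≡lcmSum x = mod-trans (F≡A x)
    (binomSum-cong (λ k → dividesMod⇒≡-mod M (lcmUpTo (toℕ k)) (a k) (div k)) (toℕ x))

-- Subtracting Σ_{j<k} lcm(j)·t_j·C(x, j), with the
-- quotients t_j given by the induction hypothesis, leaves a congruence-preserving G
-- whose coordinates below k vanish and whose k-th coordinate is a_k.  By the
-- leading-coefficient lemma every divisor e ≤ k of M divides a_k, hence so does
-- gcd(lcm(k), M), and Bézout turns this into divisibility in ℤ/Mℤ.
preservesCong⇒divisibility : ∀ {N M} .{{_ : NonZero M}} (F : Fin N → ℤ) (a : Fin N → Fin M) →
  PreservesCong M F → (∀ x → F x ≡ binomSum (coordinates a) (toℕ x) ⟨mod + M ⟩) →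
  ∀ k → DividesMod M (lcmUpTo (toℕ k)) (a k)
preservesCong⇒divisibility {N} {M} F a pF F≡A =
  All.wfRec <-wellFounded _ (λ k → DividesMod M (lcmUpTo (toℕ k)) (a k)) step
  where
  A = coordinates a
  step : ∀ k → (∀ {j} → toℕ j < toℕ k → DividesMod M (lcmUpTo (toℕ j)) (a j)) →
         DividesMod M (lcmUpTo (toℕ k)) (a k)
  step k IH = gcd∣⇒dividesMod M L (a k)
    (bounded-divisors (toℕ k) (ℕ.≢-nonZero⁻¹ M) divides-a-k (gcd L M) (gcd[m,n]∣n L M) (gcd[m,n]∣m L M))
    where
    L = lcmUpTo (toℕ k)
    t : Fin N → ℤ
    t j with toℕ j ℕ.<? toℕ k
    ... | yes j<k = + toℕ (proj₁ (IH j<k))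
    ... | no  _   = 0ℤ
    r : Fin N → ℤ
    r j = A j - lcmMultiples t j
    r-low : ∀ j → toℕ j < toℕ k → r j ≡ 0ℤ ⟨mod + M ⟩
    r-low j j<k with toℕ j ℕ.<? toℕ k
    ... | yes j<k′ = ≡-mod⇒difference≡0 (dividesMod⇒≡-mod M (lcmUpTo (toℕ j)) (a j) (IH j<k′))
    ... | no  j≮k  = contradiction j<k j≮k
    r-top : r k ≡ A k
    r-top with toℕ k ℕ.<? toℕ k
    ... | yes k<k = contradiction k<k (ℕ.<-irrefl refl)
    ... | no  _   = drop-zero (A k) (+ L)
      where
      drop-zero : ∀ x l → x - l * 0ℤ ≡ x
      drop-zero = solve-∀
    G : Fin N → ℤ
    G x = F x - binomSum (lcmMultiples t) (toℕ x)
    G≡r : ∀ x → G x ≡ binomSum r (toℕ x) ⟨mod + M ⟩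
    G≡r x = mod-trans (mod-- (F≡A x) (mod-refl (binomSum (lcmMultiples t) (toℕ x))))
                      (≡⇒≡-mod (binomSum-sub A (lcmMultiples t) (toℕ x)))
    pG : PreservesCong M G
    pG = preservesCong-sub pF (λ e _ x y → binomSum-lcmMultiples-cong t (toℕ x) (toℕ y))
    divides-a-k : ∀ e → e ∣ M → 0 < e → e ≤ toℕ k → e ∣ toℕ (a k)
    divides-a-k e e∣M 0<e e≤k = ≡-mod-0⇒∣ (toℕ (a k))
      (subst (_≡ 0ℤ ⟨mod + e ⟩) r-top (leading-coefficient M G r k pG G≡r r-low e e∣M 0<e e≤k))

theorem3p2 : (n m : ℕ) → (f : Fin (suc n) → Fin (suc m)) → (a : Fin (suc n) → Fin (suc m)) →
    (∀ (x : Fin (suc n)) → toℕ (f x) ≡ binomExpansion (suc n) (suc m) a (toℕ x)) →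
    (CongruencePreserving (suc n) (suc m) f ⇔ (∀ (k : Fin (suc n)) → DividesMod (suc m) (lcmUpTo (toℕ k)) (a k)))
theorem3p2 n m f a expansion = mk⇔
  (λ cp → preservesCong⇒divisibility F a (to (congruencePreserving⇔ f) cp) F≡A)
  (λ div → from (congruencePreserving⇔ f) (divisibility⇒preservesCong F a F≡A div))
  where
  open Equivalence using (to; from)
  F : Fin (suc n) → ℤ
  F x = + toℕ (f x)
  F≡A : ∀ x → F x ≡ binomSum (coordinates a) (toℕ x) ⟨mod + suc m ⟩
  F≡A x = mod-trans (≡⇒≡-mod (cong +_ (expansion x)))
                    (binomExpansion≡binomSum (suc n) (suc m) a (toℕ x))
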